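{- Let $G$ be a connected graph with $n$ vertices and diameter $d$. Then $$\sigma_2(G)\ge g_2(d)+(n-1-d)\Big\lceil\frac d2\Big\rceil\Big(\Big\lceil\frac d2\Big\rceil+1\Big).$$ Equality holds for the tree obtained from a path $u_0u_1\cdots u_d$ of length $d$ by attaching $n-d-1$ leaves to a vertex $u_j$ of the path with $\max\{j,d-j\}=\lceil d/2\rceil$.
   Context: Graphs are finite, simple and undirected. For a connected graph $G$ and vertex $u$, $\varepsilon_G(u)=\max_{v\in V(G)}d_G(u,v)$, and $\sigma_2(G)=\sum_{uv\in E(G)}\varepsilon_G(u)\varepsilon_G(v)$. For $0\le i\le d$ let $\delta_i=\max\{i,d-i\}$, and $g_2(d)=\sum_{i=0}^{d-1}\delta_i\delta_{i+1}$. -}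

module Defs where

open import Data.Nat using (ℕ; zero; suc; _+_; _*_; _∸_; _⊔_; _≤_; _<ᵇ_; _≡ᵇ_; ⌈_/2⌉)
open import Data.Bool using (Bool; true; false; _∧_; _∨_; if_then_else_; not)
open import Data.Fin using (Fin; toℕ)
open import Data.List using (List; map; foldr; allFin; upTo; concatMap)
open import Data.Nat.ListAction using (sum)
open import Data.Bool.ListAction using (any)
open import Relation.Binary.PropositionalEquality using (_≡_)
open import Data.Product using (∃)

Graph : ℕ → Set
Graph n = Fin n → Fin n → Bool

record IsSimple {n : ℕ} (G : Graph n) : Set where
  field
    sym   : ∀ u v → G u v ≡ G v u
    irref : ∀ u → G u u ≡ false

_==_ : {n : ℕ} → Fin n → Fin n → Bool
u == v = toℕ u ≡ᵇ toℕ v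

walk≤ : {n : ℕ} → Graph n → ℕ → Fin n → Fin n → Bool
walk≤ G zero    u v = u == v
walk≤ G (suc k) u v = walk≤ G k u v ∨ any (λ w → G u w ∧ walk≤ G k w v) (allFin _)

Connected : {n : ℕ} → Graph n → Set
Connected G = ∀ u v → ∃ λ k → walk≤ G k u v ≡ true

private
  search : {n : ℕ} → Graph n → Fin n → Fin n → ℕ → ℕ → ℕ
  search G u v start zero = start
  search G u v start (suc fuel) =
    if walk≤ G start u v then start else search G u v (suc start) fuel

-- distance d_G(u,v): length of a shortest u–v walk (any shortest walk in a
-- connected graph on n vertices has length < n, so searching k = 0..n suffices)
dist : {n : ℕ} → Graph n → Fin n → Fin n → ℕ
dist {n} G u v = search G u v 0 n

maximum : List ℕ → ℕ
maximum = foldr _⊔_ 0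

ecc : {n : ℕ} → Graph n → Fin n → ℕ
ecc {n} G u = maximum (map (dist G u) (allFin n))

diameter : {n : ℕ} → Graph n → ℕ
diameter {n} G = maximum (map (ecc G) (allFin n))

σ₂ : {n : ℕ} → Graph n → ℕ
σ₂ {n} G = sum (concatMap (λ u → map (λ v →
  if (toℕ u <ᵇ toℕ v) ∧ G u v then ecc G u * ecc G v else 0) (allFin n)) (allFin n))

δ : ℕ → ℕ → ℕ
δ d i = i ⊔ (d ∸ i)

g₂ : ℕ → ℕ
g₂ d = sum (map (λ i → δ d i * δ d (suc i)) (upTo d))

bound : ℕ → ℕ → ℕ
bound n d = g₂ d + (n ∸ 1 ∸ d) * (⌈ d /2⌉ * (⌈ d /2⌉ + 1))

-- The extremal tree on Fin n: vertices 0..d form the path u_0 u_1 ... u_d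
-- (u_i = vertex i), and each vertex with index > d is a leaf attached to u_j.
private
  adjℕ : ℕ → ℕ → ℕ → ℕ → Bool
  adjℕ d j a b =
    (not (d <ᵇ a) ∧ not (d <ᵇ b) ∧ ((suc a ≡ᵇ b) ∨ (suc b ≡ᵇ a)))
    ∨ ((d <ᵇ a) ∧ (b ≡ᵇ j))
    ∨ ((d <ᵇ b) ∧ (a ≡ᵇ j))

extremalTree : (n d j : ℕ) → Graph n
extremalTree n d j u v = adjℕ d j (toℕ u) (toℕ v)

module Submission where

open import Defs
open import Data.Bool using (Bool; true; false; _∧_; _∨_; if_then_else_; not)
open import Data.Bool.ListAction using (any)
open import Data.Bool.Properties using (∧-identityʳ; T-≡)
open import Data.Empty using (⊥; ⊥-elim)
open import Data.Fin using (Fin; zero; suc; toℕ; fromℕ<)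
import Data.Fin.Properties as Fin
open import Data.List using (List; map; foldr; allFin; applyUpTo; concatMap; tabulate)
open import Data.Nat using (ℕ; zero; suc; _+_; _*_; _∸_; _⊔_; _⊓_; _≤_; _<_; z≤n; s≤s; s≤s⁻¹; _<ᵇ_; _≡ᵇ_; ⌈_/2⌉; pred)
open import Data.Nat using (NonZero; ≢-nonZero; >-nonZero; _≤?_; _<?_; _≟_)
open import Data.Nat.ListAction using (sum)
import Data.Nat.ListAction.Properties as ListSum
open import Data.Nat.Properties
open import Data.Nat.Tactic.RingSolver using (solve-∀)
open import Data.Product using (∃; _×_; _,_; proj₁; proj₂)
open import Data.Sum using (_⊎_; inj₁; inj₂; [_,_]′)
import Data.Vec.Functional as Vector
open import Function using (_∘_; Equivalence)
open import Relation.Binary using (tri<; tri≈; tri>)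
open import Relation.Binary.PropositionalEquality using (_≡_; _≢_; refl; sym; trans; cong; cong₂; subst; subst₂)
open import Relation.Binary.PropositionalEquality using (module ≡-Reasoning)
open import Relation.Nullary using (Dec; yes; no)
open import Algebra.Properties.CommutativeMonoid.Sum +-0-commutativeMonoid
  using (sum-syntax; sum-cong-≗; ∑-distrib-+; ∑-comm)

-- Let u₀ have maximal eccentricity, let u_d be at distance d from u₀, and fix a
-- shortest path u₀ u₁ … u_d.  With a, b the distances to u₀ and u_d, every vertex
-- has ε ≥ max(a, b) ≥ ⌈d/2⌉, and ε(u_i) ≥ δ_i.  Charge every edge to its endpoint
-- of larger rank min(2a, 2b+1).  Consecutive path vertices have different ranks,
-- so the path edges contribute at least g₂(d).  A vertex off the path has a
-- neighbour of smaller rank on a shortest walk towards u₀ or u_d, and the edges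
-- charged to it contribute at least ⌈d/2⌉(⌈d/2⌉+1); there are n − 1 − d such
-- vertices.  In the extremal tree the eccentricities are at most δ_i on the path
-- and ⌈d/2⌉ + 1 on the leaves, which bounds σ₂ from above by the same quantity.

∨-true⁻ : ∀ a b → a ∨ b ≡ true → a ≡ true ⊎ b ≡ true
∨-true⁻ true  b _ = inj₁ refl
∨-true⁻ false b e = inj₂ e

∨-trueˡ : ∀ {a} b → a ≡ true → a ∨ b ≡ true
∨-trueˡ b refl = refl

∨-trueʳ : ∀ a {b} → b ≡ true → a ∨ b ≡ true
∨-trueʳ true  _ = refl
∨-trueʳ false e = e

∧-true⁻ : ∀ a b → a ∧ b ≡ true → a ≡ true × b ≡ true
∧-true⁻ true true _ = refl , refl

∧-true⁺ : ∀ {a b} → a ≡ true → b ≡ true → a ∧ b ≡ true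
∧-true⁺ refl refl = refl

≡ᵇ-refl : ∀ m → (m ≡ᵇ m) ≡ true
≡ᵇ-refl m = Equivalence.to T-≡ (≡⇒≡ᵇ m m refl)

≡ᵇ-true⇒≡ : ∀ m k → (m ≡ᵇ k) ≡ true → m ≡ k
≡ᵇ-true⇒≡ m k = ≡ᵇ⇒≡ m k ∘ Equivalence.from T-≡

≢⇒≡ᵇ-false : ∀ m k → m ≢ k → (m ≡ᵇ k) ≡ false
≢⇒≡ᵇ-false zero    zero    m≢k = ⊥-elim (m≢k refl)
≢⇒≡ᵇ-false zero    (suc k) _   = refl
≢⇒≡ᵇ-false (suc m) zero    _   = refl
≢⇒≡ᵇ-false (suc m) (suc k) m≢k = ≢⇒≡ᵇ-false m k (m≢k ∘ cong suc)

<ᵇ-true⇒< : ∀ m k → (m <ᵇ k) ≡ true → m < k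
<ᵇ-true⇒< m k = <ᵇ⇒< m k ∘ Equivalence.from T-≡

<ᵇ-false⇒≥ : ∀ m k → (m <ᵇ k) ≡ false → k ≤ m
<ᵇ-false⇒≥ m       zero    _ = z≤n
<ᵇ-false⇒≥ (suc m) (suc k) e = s≤s (<ᵇ-false⇒≥ m k e)

<⇒<ᵇ-true : ∀ {m k} → m < k → (m <ᵇ k) ≡ true
<⇒<ᵇ-true = Equivalence.to T-≡ ∘ <⇒<ᵇ

≥⇒<ᵇ-false : ∀ {m k} → k ≤ m → (m <ᵇ k) ≡ false
≥⇒<ᵇ-false {m}     {zero}  _         = refl
≥⇒<ᵇ-false {suc m} {suc k} (s≤s k≤m) = ≥⇒<ᵇ-false k≤m

==-true⇒≡ : ∀ {n} (u v : Fin n) → u == v ≡ true → u ≡ v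
==-true⇒≡ u v e = Fin.toℕ-injective (≡ᵇ-true⇒≡ (toℕ u) (toℕ v) e)

==-refl : ∀ {n} (u : Fin n) → u == u ≡ true
==-refl u = ≡ᵇ-refl (toℕ u)

any-tabulate-true⁻ : ∀ {A : Set} {k} (g : Fin k → A) (q : A → Bool) →
                     any q (tabulate g) ≡ true → ∃ λ i → q (g i) ≡ true
any-tabulate-true⁻ {k = suc k} g q e with ∨-true⁻ (q (g zero)) _ e
... | inj₁ e₀   = zero , e₀
... | inj₂ rest with any-tabulate-true⁻ (g ∘ suc) q rest
...   | i , eᵢ = suc i , eᵢ

any-tabulate-true⁺ : ∀ {A : Set} {k} (g : Fin k → A) (q : A → Bool) i →
                     q (g i) ≡ true → any q (tabulate g) ≡ true
any-tabulate-true⁺ g q zero    e = ∨-trueˡ _ e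
any-tabulate-true⁺ g q (suc i) e = ∨-trueʳ (q (g zero)) (any-tabulate-true⁺ (g ∘ suc) q i e)

∑-mono-≤ : ∀ {n} {f g : Fin n → ℕ} → (∀ i → f i ≤ g i) → ∑[ i < n ] f i ≤ ∑[ i < n ] g i
∑-mono-≤ {zero}  f≤g = z≤n
∑-mono-≤ {suc n} f≤g = +-mono-≤ (f≤g zero) (∑-mono-≤ (f≤g ∘ suc))

∑-const : ∀ n c → ∑[ i < n ] c ≡ n * c
∑-const zero    c = refl
∑-const (suc n) c = cong (c +_) (∑-const n c)

∑-zero : ∀ n → ∑[ i < n ] 0 ≡ 0
∑-zero n = trans (∑-const n 0) (*-zeroʳ n)

term≤∑ : ∀ {n} (f : Fin n → ℕ) i → f i ≤ ∑[ j < n ] f j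
term≤∑ f zero    = m≤m+n (f zero) _
term≤∑ f (suc i) = ≤-trans (term≤∑ (f ∘ suc) i) (m≤n+m _ (f zero))

two-terms≤∑ : ∀ {n} (f : Fin n → ℕ) {i j} → i ≢ j → f i + f j ≤ ∑[ k < n ] f k
two-terms≤∑ f {zero}  {zero}  i≢j = ⊥-elim (i≢j refl)
two-terms≤∑ f {zero}  {suc j} i≢j = +-monoʳ-≤ (f zero) (term≤∑ (f ∘ suc) j)
two-terms≤∑ f {suc i} {zero}  i≢j =
  ≤-trans (≤-reflexive (+-comm (f (suc i)) (f zero))) (+-monoʳ-≤ (f zero) (term≤∑ (f ∘ suc) i))
two-terms≤∑ f {suc i} {suc j} i≢j =
  ≤-trans (two-terms≤∑ (f ∘ suc) (i≢j ∘ cong suc)) (m≤n+m _ (f zero))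

∑-indicator : ∀ {n} (k : Fin n) c → ∑[ i < n ] (if i == k then c else 0) ≡ c
∑-indicator {suc n} zero    c = trans (cong (c +_) (∑-zero n)) (+-identityʳ c)
∑-indicator {suc n} (suc k) c = ∑-indicator k c

⨆ : ∀ {n} → (Fin n → ℕ) → ℕ
⨆ = Vector.foldr _⊔_ 0

⨆-upper : ∀ {n} (f : Fin n → ℕ) i → f i ≤ ⨆ f
⨆-upper f zero    = m≤m⊔n (f zero) _
⨆-upper f (suc i) = ≤-trans (⨆-upper (f ∘ suc) i) (m≤n⊔m (f zero) _)

⨆-least : ∀ {n} (f : Fin n → ℕ) {c} → (∀ i → f i ≤ c) → ⨆ f ≤ c
⨆-least {zero}  f f≤c = z≤n
⨆-least {suc n} f f≤c = ⊔-lub (f≤c zero) (⨆-least (f ∘ suc) (f≤c ∘ suc))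

⨆-attained : ∀ {n} (f : Fin (suc n) → ℕ) → ∃ λ i → ⨆ f ≡ f i
⨆-attained {zero}  f = zero , ⊔-identityʳ (f zero)
⨆-attained {suc n} f with ⊔-sel (f zero) (⨆ (f ∘ suc))
... | inj₁ ⨆≡f₀ = zero , ⨆≡f₀
... | inj₂ ⨆≡⨆tail with ⨆-attained (f ∘ suc)
...   | i , eq = suc i , trans ⨆≡⨆tail eq

foldr-map-tabulate : ∀ {A B : Set} (_∙_ : B → B → B) e (f : A → B) {n} (g : Fin n → A) →
                     foldr _∙_ e (map f (tabulate g)) ≡ Vector.foldr _∙_ e (f ∘ g)
foldr-map-tabulate _∙_ e f {zero}  g = refl
foldr-map-tabulate _∙_ e f {suc n} g = cong (f (g zero) ∙_) (foldr-map-tabulate _∙_ e f (g ∘ suc))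

sum-concatMap-tabulate : ∀ {A : Set} (F : A → List ℕ) {n} (g : Fin n → A) →
                         sum (concatMap F (tabulate g)) ≡ ∑[ i < n ] sum (F (g i))
sum-concatMap-tabulate F {zero}  g = refl
sum-concatMap-tabulate F {suc n} g =
  trans (ListSum.sum-++ (F (g zero)) _) (cong (sum (F (g zero)) +_) (sum-concatMap-tabulate F (g ∘ suc)))

sum-map-applyUpTo : ∀ (f g : ℕ → ℕ) k → sum (map f (applyUpTo g k)) ≡ ∑[ i < k ] f (g (toℕ i))
sum-map-applyUpTo f g zero    = refl
sum-map-applyUpTo f g (suc k) = cong (f (g 0) +_) (sum-map-applyUpTo f (g ∘ suc) k)

∑-snoc : ∀ k (f : ℕ → ℕ) → ∑[ i < suc k ] f (toℕ i) ≡ ∑[ i < k ] f (toℕ i) + f k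
∑-snoc zero    f = +-comm (f 0) 0
∑-snoc (suc k) f = trans (cong (f 0 +_) (∑-snoc k (f ∘ suc))) (sym (+-assoc (f 0) _ _))

∑-toℕ-indicator : ∀ {k m} c → m < k → ∑[ i < k ] (if toℕ i ≡ᵇ m then c else 0) ≡ c
∑-toℕ-indicator {suc k} {zero}  c _         = trans (cong (c +_) (∑-zero k)) (+-identityʳ c)
∑-toℕ-indicator {suc k} {suc m} c (s≤s m<k) = ∑-toℕ-indicator c m<k

∑-truncate : ∀ {k m} (g : ℕ → ℕ) → m ≤ k →
             ∑[ i < k ] (if toℕ i <ᵇ m then g (toℕ i) else 0) ≡ ∑[ i < m ] g (toℕ i)
∑-truncate {k}     {zero}  g _         = ∑-zero k
∑-truncate {suc k} {suc m} g (s≤s m≤k) = cong (g 0 +_) (∑-truncate (g ∘ suc) m≤k)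

∑-tail-const : ∀ k m c → ∑[ i < k ] (if m <ᵇ toℕ i then c else 0) ≡ (k ∸ suc m) * c
∑-tail-const zero    m       c = refl
∑-tail-const (suc k) zero    c = ∑-const k c
∑-tail-const (suc k) (suc m) c = ∑-tail-const k m c

m+m≤n+n⇒m≤n : ∀ {m n} → m + m ≤ n + n → m ≤ n
m+m≤n+n⇒m≤n {m} {n} 2m≤2n with m ≤? n
... | yes m≤n = m≤n
... | no  m≰n = ⊥-elim (<⇒≱ (+-mono-< (≰⇒> m≰n) (≰⇒> m≰n)) 2m≤2n)

∑∑-mono-≤-symmetrised : ∀ {n} (f g : Fin n → Fin n → ℕ) → (∀ x y → f x y + f y x ≤ g x y + g y x) →
                       ∑[ x < n ] ∑[ y < n ] f x y ≤ ∑[ x < n ] ∑[ y < n ] g x y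
∑∑-mono-≤-symmetrised {n} f g f≤g = m+m≤n+n⇒m≤n (begin
  F + F                                                    ≡⟨ cong (F +_) (∑-comm f) ⟩
  F + ∑[ x < n ] ∑[ y < n ] f y x                          ≡⟨ sym (∑-distrib-+ (λ x → ∑[ y < n ] f x y) _) ⟩
  ∑[ x < n ] (∑[ y < n ] f x y + ∑[ y < n ] f y x)          ≡⟨ sum-cong-≗ (λ x → sym (∑-distrib-+ (f x) _)) ⟩
  ∑[ x < n ] ∑[ y < n ] (f x y + f y x)                    ≤⟨ ∑-mono-≤ (λ x → ∑-mono-≤ (f≤g x)) ⟩
  ∑[ x < n ] ∑[ y < n ] (g x y + g y x)                    ≡⟨ sum-cong-≗ (λ x → ∑-distrib-+ (g x) _) ⟩
  ∑[ x < n ] (∑[ y < n ] g x y + ∑[ y < n ] g y x)          ≡⟨ ∑-distrib-+ (λ x → ∑[ y < n ] g x y) _ ⟩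
  G′ + ∑[ x < n ] ∑[ y < n ] g y x                         ≡⟨ cong (G′ +_) (sym (∑-comm g)) ⟩
  G′ + G′                                                  ∎)
  where
  open ≤-Reasoning
  F G′ : ℕ
  F  = ∑[ x < n ] ∑[ y < n ] f x y
  G′ = ∑[ x < n ] ∑[ y < n ] g x y

σ₂≡∑∑ : ∀ {n} (G : Graph n) →
        σ₂ G ≡ ∑[ u < n ] ∑[ v < n ] (if (toℕ u <ᵇ toℕ v) ∧ G u v then ecc G u * ecc G v else 0)
σ₂≡∑∑ {n} G = trans (sum-concatMap-tabulate (λ u → map (term u) (allFin n)) (λ u → u))
                    (sum-cong-≗ (λ u → foldr-map-tabulate _+_ 0 (term u) (λ v → v)))
  where
  term : Fin n → Fin n → ℕ
  term u v = if (toℕ u <ᵇ toℕ v) ∧ G u v then ecc G u * ecc G v else 0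

g₂≡∑ : ∀ d → g₂ d ≡ ∑[ i < d ] (δ d (toℕ i) * δ d (suc (toℕ i)))
g₂≡∑ d = sum-map-applyUpTo (λ i → δ d i * δ d (suc i)) (λ i → i) d

∑-over-section : ∀ {N k} (p : ℕ → Fin N) (a : Fin N → ℕ) → (∀ {i} → i < k → a (p i) ≡ i) →
                 (∀ x → a x < k) → (F : ℕ → ℕ) →
                 ∑[ x < N ] (if x == p (a x) then F (a x) else 0) ≡ ∑[ i < k ] F (toℕ i)
∑-over-section {N} {k} p a a∘p≡id a<k F = sym (begin
  ∑[ i < k ] F (toℕ i)
    ≡⟨ sum-cong-≗ {k} (λ i → sym (∑-indicator (p (toℕ i)) (F (toℕ i)))) ⟩
  ∑[ i < k ] ∑[ x < N ] (if x == p (toℕ i) then F (toℕ i) else 0)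
    ≡⟨ ∑-comm {k} {N} (λ i x → if x == p (toℕ i) then F (toℕ i) else 0) ⟩
  ∑[ x < N ] ∑[ i < k ] (if x == p (toℕ i) then F (toℕ i) else 0)
    ≡⟨ sum-cong-≗ {N} column ⟩
  ∑[ x < N ] (if x == p (a x) then F (a x) else 0) ∎)
  where
  open ≡-Reasoning
  column : ∀ x → ∑[ i < k ] (if x == p (toℕ i) then F (toℕ i) else 0) ≡ (if x == p (a x) then F (a x) else 0)
  column x = trans (sum-cong-≗ term) (∑-toℕ-indicator _ (a<k x))
    where
    term : ∀ i → (if x == p (toℕ i) then F (toℕ i) else 0) ≡
                 (if toℕ i ≡ᵇ a x then (if x == p (a x) then F (a x) else 0) else 0)
    term i with x == p (toℕ i) in x≡pᵢ
    ... | true rewrite trans (cong a (==-true⇒≡ x _ x≡pᵢ)) (a∘p≡id (Fin.toℕ<n i))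
                     | ≡ᵇ-refl (toℕ i) | x≡pᵢ = refl
    ... | false with toℕ i ≡ᵇ a x in i≡ax
    ...   | false = refl
    ...   | true rewrite sym (≡ᵇ-true⇒≡ (toℕ i) (a x) i≡ax) | x≡pᵢ = refl

⌈/2⌉≤ : ∀ {d e} → d ≤ e + e → ⌈ d /2⌉ ≤ e
⌈/2⌉≤ {e = e} d≤2e = ≤-trans (⌈n/2⌉-mono d≤2e) (≤-reflexive (sym (n≡⌈n+n/2⌉ e)))

⌈/2⌉+⌈/2⌉≤1+ : ∀ d → ⌈ d /2⌉ + ⌈ d /2⌉ ≤ suc d
⌈/2⌉+⌈/2⌉≤1+ zero          = z≤n
⌈/2⌉+⌈/2⌉≤1+ (suc zero)    = s≤s (s≤s z≤n)
⌈/2⌉+⌈/2⌉≤1+ (suc (suc d)) =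
  s≤s (≤-trans (≤-reflexive (+-suc ⌈ d /2⌉ ⌈ d /2⌉)) (s≤s (⌈/2⌉+⌈/2⌉≤1+ d)))

⌈/2⌉< : ∀ {d} → 2 ≤ d → ⌈ d /2⌉ < d
⌈/2⌉< {suc zero}    (s≤s ())
⌈/2⌉< {suc (suc d)} _ = ⌈n/2⌉<n d

m+m≢1+k+k : ∀ m k → m + m ≢ suc (k + k)
m+m≢1+k+k m k e = even≢odd m k (begin
  m + (m + 0)        ≡⟨ cong (m +_) (+-identityʳ m) ⟩
  m + m              ≡⟨ e ⟩
  suc (k + k)        ≡⟨ cong (λ t → suc (k + t)) (sym (+-identityʳ k)) ⟩
  suc (k + (k + 0))  ∎)
  where open ≡-Reasoning

≢0⇒≡suc-pred : ∀ {m} → m ≢ 0 → m ≡ suc (pred m)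
≢0⇒≡suc-pred {m} m≢0 = sym (suc-pred m {{≢-nonZero m≢0}})

r*[r+1]≤r*r+r*r : ∀ {r} → 1 ≤ r → r * (r + 1) ≤ r * r + r * r
r*[r+1]≤r*r+r*r {suc k} _ = ≤-trans (m≤m+n _ (k * k + k)) (≤-reflexive (identity k))
  where
  identity : ∀ k → suc k * (suc k + 1) + (k * k + k) ≡ suc k * suc k + suc k * suc k
  identity = solve-∀

r*[r+1]≤ : ∀ {r x y} → (suc r ≤ x × r ≤ y) ⊎ (r ≤ x × suc r ≤ y) → r * (r + 1) ≤ x * y
r*[r+1]≤ {r} {x} (inj₁ (r<x , r≤y)) = ≤-trans (≤-reflexive (*-comm r (r + 1)))
                                          (*-mono-≤ (subst (_≤ x) (+-comm 1 r) r<x) r≤y)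
r*[r+1]≤ {r} {y = y} (inj₂ (r≤x , r<y)) = *-mono-≤ r≤x (subst (_≤ y) (+-comm 1 r) r<y)

if-mono-≤ : ∀ (c : Bool) {m k} → m ≤ k → (if c then m else 0) ≤ (if c then k else 0)
if-mono-≤ true  m≤k = m≤k
if-mono-≤ false _   = z≤n

if-zero : ∀ (c : Bool) → (if c then 0 else 0) ≡ 0
if-zero true  = refl
if-zero false = refl

if-split : ∀ (c : Bool) m k → (if c then m else k) ≡ (if c then m else 0) + (if c then 0 else k)
if-split true  m k = sym (+-identityʳ m)
if-split false m k = refl

if-<ᵇ-exclusive : ∀ p q c → (if q <ᵇ p then c else 0) + (if p <ᵇ q then c else 0) ≤ c
if-<ᵇ-exclusive p q c with q <ᵇ p in q<p
... | true  rewrite ≥⇒<ᵇ-false {p} {q} (<⇒≤ (<ᵇ-true⇒< q p q<p)) = ≤-reflexive (+-identityʳ c)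
... | false with p <ᵇ q
...   | true  = ≤-refl
...   | false = z≤n

if-<ᵇ-exhaustive : ∀ {p q} c → p ≢ q → c ≤ (if p <ᵇ q then c else 0) + (if q <ᵇ p then c else 0)
if-<ᵇ-exhaustive {p} {q} c p≢q with <-cmp p q
... | tri< p<q _ _ rewrite <⇒<ᵇ-true p<q | ≥⇒<ᵇ-false (<⇒≤ p<q) = ≤-reflexive (sym (+-identityʳ c))
... | tri≈ _ p≡q _ = ⊥-elim (p≢q p≡q)
... | tri> _ _ q<p rewrite <⇒<ᵇ-true q<p | ≥⇒<ᵇ-false (<⇒≤ q<p) = ≤-refl

-- The rank of a vertex at distances α and β from the two ends of a diametral path.
rank : ℕ → ℕ → ℕ
rank α β = (α + α) ⊓ suc (β + β)

rank-<ˡ : ∀ {α α′ β β′} → α′ < α → α ≤ β → rank α′ β′ < rank α β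
rank-<ˡ {α} {α′} {β} {β′} α′<α α≤β = begin-strict
  rank α′ β′  ≤⟨ m⊓n≤m (α′ + α′) _ ⟩
  α′ + α′     <⟨ +-mono-< α′<α α′<α ⟩
  α + α       ≡⟨ sym (m≤n⇒m⊓n≡m (≤-trans (+-mono-≤ α≤β α≤β) (n≤1+n _))) ⟩
  rank α β    ∎
  where open ≤-Reasoning

rank-<ʳ : ∀ {α α′ β β′} → β′ < β → β ≤ α → rank α′ β′ < rank α β
rank-<ʳ {α} {α′} {β} {β′} β′<β β≤α = begin-strict
  rank α′ β′                  ≤⟨ m⊓n≤n (α′ + α′) _ ⟩
  suc (β′ + β′)               <⟨ ≤-trans (≤-reflexive (cong suc (sym (+-suc β′ β′)))) (+-mono-≤ β′<β β′<β) ⟩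
  β + β                       ≤⟨ ⊓-glb (+-mono-≤ β≤α β≤α) (n≤1+n (β + β)) ⟩
  rank α β                    ∎
  where open ≤-Reasoning

m+m<[1+m]+[1+m] : ∀ m → m + m < suc m + suc m
m+m<[1+m]+[1+m] m = s≤s (+-monoʳ-≤ m (n≤1+n m))

rank-step-≢ : ∀ α β → rank α (suc β) ≢ rank (suc α) β
rank-step-≢ α β e with ⊓-sel (α + α) (suc (suc β + suc β)) | ⊓-sel (suc α + suc α) (suc (β + β))
... | inj₁ e₁ | inj₁ e₂ = <⇒≢ (m+m<[1+m]+[1+m] α) (trans (sym e₁) (trans e e₂))
... | inj₁ e₁ | inj₂ e₂ = m+m≢1+k+k α β (trans (sym e₁) (trans e e₂))
... | inj₂ e₁ | inj₁ e₂ = m+m≢1+k+k (suc α) (suc β) (sym (trans (sym e₁) (trans e e₂)))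
... | inj₂ e₁ | inj₂ e₂ = <⇒≢ (s≤s (m+m<[1+m]+[1+m] β)) (sym (trans (sym e₁) (trans e e₂)))

-- Walks and distances

module Walks {n : ℕ} (G : Graph n) where

  data Walk : ℕ → Fin n → Fin n → Set where
    here : ∀ {u} → Walk 0 u u
    step : ∀ {m u w v} → G u w ≡ true → Walk m w v → Walk (suc m) u v

  walk≤-sound : ∀ k u v → walk≤ G k u v ≡ true → ∃ λ m → m ≤ k × Walk m u v
  walk≤-sound zero u v e with ==-true⇒≡ u v e
  ... | refl = 0 , z≤n , here
  walk≤-sound (suc k) u v e with ∨-true⁻ (walk≤ G k u v) _ e
  ... | inj₁ shorter with walk≤-sound k u v shorter
  ...   | m , m≤k , p = m , m≤n⇒m≤1+n m≤k , p
  walk≤-sound (suc k) u v e | inj₂ viaNeighbour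
    with any-tabulate-true⁻ (λ w → w) (λ w → G u w ∧ walk≤ G k w v) viaNeighbour
  ... | w , e′ with ∧-true⁻ (G u w) _ e′
  ...   | uw , rest with walk≤-sound k w v rest
  ...     | m , m≤k , p = suc m , s≤s m≤k , step uw p

  walk≤-complete : ∀ k {m u v} → Walk m u v → m ≤ k → walk≤ G k u v ≡ true
  walk≤-complete zero    {u = u} here z≤n = ==-refl u
  walk≤-complete (suc k)         here _   = ∨-trueˡ _ (walk≤-complete k here z≤n)
  walk≤-complete (suc k) {u = u} {v = v} (step {w = w} uw p) (s≤s m≤k) =
    ∨-trueʳ (walk≤ G k u v)
      (any-tabulate-true⁺ (λ x → x) (λ x → G u x ∧ walk≤ G k x v) w (∧-true⁺ uw (walk≤-complete k p m≤k)))

  _++ʷ_ : ∀ {m m′ u v w} → Walk m u v → Walk m′ v w → Walk (m + m′) u w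
  here      ++ʷ q = q
  step uw p ++ʷ q = step uw (p ++ʷ q)

  snoc : ∀ {m u v w} → Walk m u v → G v w ≡ true → Walk (suc m) u w
  snoc here        vw = step vw here
  snoc (step uw p) vw = step uw (snoc p vw)

  unsnoc : ∀ {m u v} → Walk (suc m) u v → ∃ λ w → Walk m u w × G w v ≡ true
  unsnoc (step uv here) = _ , here , uv
  unsnoc (step uw (step ww′ p)) with unsnoc (step ww′ p)
  ... | x , q , xv = x , step uw q , xv

  Walk-zero⇒≡ : ∀ {u v} → Walk 0 u v → u ≡ v
  Walk-zero⇒≡ here = refl

  vertex : ∀ {m u v} → Walk m u v → ℕ → Fin n
  vertex {u = u} p          zero    = u
  vertex {v = v} here       (suc i) = v
  vertex         (step _ p) (suc i) = vertex p i

  prefix : ∀ {m u v} (p : Walk m u v) {i} → i ≤ m → Walk i u (vertex p i)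
  prefix p           {zero}  _         = here
  prefix (step uw p) {suc i} (s≤s i≤m) = step uw (prefix p i≤m)

  suffix : ∀ {m u v} (p : Walk m u v) i → Walk (m ∸ i) (vertex p i) v
  suffix p          zero    = p
  suffix here       (suc i) = here
  suffix (step _ p) (suc i) = suffix p i

  vertex-edge : ∀ {m u v} (p : Walk m u v) {i} → i < m → G (vertex p i) (vertex p (suc i)) ≡ true
  vertex-edge (step uw p) {zero}  _         = uw
  vertex-edge (step _ p)  {suc i} (s≤s i<m) = vertex-edge p i<m

  -- A walk visiting more than n vertices repeats one; cut out the closed piece.
  shorten : ∀ {m u v} → Walk m u v → n < suc m → ∃ λ m′ → m′ < m × Walk m′ u v
  shorten {m} {u} {v} p n<m+1 with Fin.pigeonhole n<m+1 (vertex p ∘ toℕ)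
  ... | i , j , i<j , same =
    toℕ i + (m ∸ toℕ j) ,
    ≤-trans (+-monoˡ-< (m ∸ toℕ j) i<j) (≤-reflexive (m+[n∸m]≡n j≤m)) ,
    prefix p (≤-trans (<⇒≤ i<j) j≤m) ++ʷ subst (λ x → Walk (m ∸ toℕ j) x v) (sym same) (suffix p (toℕ j))
    where
    j≤m : toℕ j ≤ m
    j≤m = s≤s⁻¹ (Fin.toℕ<n j)

  walk-shorter-than-n : ∀ b {m u v} → m ≤ b → Walk m u v → ∃ λ m′ → m′ < n × Walk m′ u v
  walk-shorter-than-n zero    {u = u} z≤n p = 0 , ≤-<-trans z≤n (Fin.toℕ<n u) , p
  walk-shorter-than-n (suc b) {m} m≤b p with m <? n
  ... | yes m<n = m , m<n , p
  ... | no  m≮n with shorten p (s≤s (≮⇒≥ m≮n))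
  ...   | m′ , m′<m , q = walk-shorter-than-n b (s≤s⁻¹ (≤-trans m′<m m≤b)) q

  reverse : (∀ u v → G u v ≡ G v u) → ∀ {m u v} → Walk m u v → Walk m v u
  reverse sym-G here                      = here
  reverse sym-G {u = u} (step {w = w} uw p) = snoc (reverse sym-G p) (trans (sym-G w u) uw)

-- Defs keeps the bounded search behind dist private.  It is recovered here as a
-- named function: the with-abstraction turns the unfolding of dist into a
-- higher-order pattern, which solves the metavariable search.
mutual
  search : {n : ℕ} → Graph n → Fin n → Fin n → ℕ → ℕ → ℕ
  search = _

  dist-unfold : ∀ {m} (G : Graph (suc m)) u v →
                dist G u v ≡ (if walk≤ G 0 u v then 0 else search G u v 1 m)
  dist-unfold {m} G u v with 1 | suc m
  ... | _ | _ = refl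

search-≤ : ∀ {n} (G : Graph n) u v s fuel k → s ≤ k → walk≤ G k u v ≡ true → search G u v s fuel ≤ k
search-≤ G u v s zero        k s≤k _ = s≤k
search-≤ G u v s (suc fuel) k s≤k e with walk≤ G s u v in found
... | true  = s≤k
... | false = search-≤ G u v (suc s) fuel k (≤∧≢⇒< s≤k s≢k) e
  where
  s≢k : s ≢ k
  s≢k refl with trans (sym found) e
  ... | ()

search-succeeds : ∀ {n} (G : Graph n) u v s fuel k → s ≤ k → k < s + fuel → walk≤ G k u v ≡ true →
                  walk≤ G (search G u v s fuel) u v ≡ true
search-succeeds G u v s zero       k s≤k k<s _ = ⊥-elim (<⇒≱ (subst (k <_) (+-identityʳ s) k<s) s≤k)
search-succeeds G u v s (suc fuel) k s≤k k<s+f e with walk≤ G s u v in found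
... | true  = found
... | false = search-succeeds G u v (suc s) fuel k (≤∧≢⇒< s≤k s≢k) (subst (k <_) (+-suc s fuel) k<s+f) e
  where
  s≢k : s ≢ k
  s≢k refl with trans (sym found) e
  ... | ()

module Distance {n : ℕ} (G : Graph n) (simple : IsSimple G) (connected : Connected G) where
  open Walks G

  -- Opaque so that type checking never unfolds the bounded search inside dist.
  opaque
    D : Fin n → Fin n → ℕ
    D = dist G

    D-≤-walk : ∀ {m u v} → Walk m u v → D u v ≤ m
    D-≤-walk {m} {u} {v} p = search-≤ G u v 0 n m z≤n (walk≤-complete m p ≤-refl)

    shortest-walk : ∀ u v → Walk (D u v) u v
    shortest-walk u v with connected u v
    ... | k , e with walk≤-sound k u v e
    ...   | m , _ , p with walk-shorter-than-n m ≤-refl p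
    ...     | m′ , m′<n , q
      with walk≤-sound (D u v) u v (search-succeeds G u v 0 n m′ z≤n m′<n (walk≤-complete m′ q ≤-refl))
    ...       | m″ , m″≤D , r = subst (λ k → Walk k u v) (≤-antisym m″≤D (D-≤-walk r)) r

    ecc≡⨆ : ∀ x → ecc G x ≡ ⨆ (D x)
    ecc≡⨆ x = foldr-map-tabulate _⊔_ 0 (dist G x) (λ y → y)

  diameter≡⨆ : diameter G ≡ ⨆ (ecc G)
  diameter≡⨆ = foldr-map-tabulate _⊔_ 0 (ecc G) (λ y → y)

  D-triangle : ∀ u v w → D u w ≤ D u v + D v w
  D-triangle u v w = D-≤-walk (shortest-walk u v ++ʷ shortest-walk v w)

  D-sym : ∀ u v → D u v ≡ D v u
  D-sym u v = ≤-antisym (D-≤-walk (reverse (IsSimple.sym simple) (shortest-walk v u)))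
                        (D-≤-walk (reverse (IsSimple.sym simple) (shortest-walk u v)))

  D-self : ∀ u → D u u ≡ 0
  D-self u = n≤0⇒n≡0 (D-≤-walk here)

  D≡0⇒≡ : ∀ {u v} → D u v ≡ 0 → u ≡ v
  D≡0⇒≡ {u} {v} e = Walk-zero⇒≡ (subst (λ k → Walk k u v) e (shortest-walk u v))

  D-edge : ∀ {u w} → G u w ≡ true → D u w ≤ 1
  D-edge uw = D-≤-walk (step uw here)

  D-across-edge : ∀ u {x w} → G x w ≡ true → D u w ≤ suc (D u x)
  D-across-edge u {x} {w} xw = begin
    D u w           ≤⟨ D-triangle u x w ⟩
    D u x + D x w   ≤⟨ +-monoʳ-≤ (D u x) (D-edge xw) ⟩
    D u x + 1       ≡⟨ +-comm (D u x) 1 ⟩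
    suc (D u x)     ∎
    where open ≤-Reasoning

  predecessor : ∀ u x {k} → D u x ≡ suc k → ∃ λ w → G x w ≡ true × D u w ≡ k
  predecessor u x {k} e with unsnoc (subst (λ m → Walk m u x) e (shortest-walk u x))
  ... | w , p , wx = w , trans (IsSimple.sym simple x w) wx , ≤-antisym (D-≤-walk p) (s≤s⁻¹ k<Dw+1)
    where
    k<Dw+1 : suc k ≤ suc (D u w)
    k<Dw+1 = subst (_≤ suc (D u w)) e (D-across-edge u wx)

  D≤ecc : ∀ x y → D x y ≤ ecc G x
  D≤ecc x y = subst (D x y ≤_) (sym (ecc≡⨆ x)) (⨆-upper (D x) y)

  ecc≤diameter : ∀ x → ecc G x ≤ diameter G
  ecc≤diameter x = subst (ecc G x ≤_) (sym diameter≡⨆) (⨆-upper (ecc G) x)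

-- The lower bound

module LowerBound {n₁ : ℕ} (G : Graph (suc n₁)) (simple : IsSimple G) (connected : Connected G) where
  open Walks G
  open Distance G simple connected

  N : ℕ
  N = suc n₁

  -- Opaque so that type checking never unfolds eccentricities or the diameter.
  opaque
    ε : Fin N → ℕ
    ε = ecc G

    d : ℕ
    d = diameter G

    d≡diameter : d ≡ diameter G
    d≡diameter = refl

    D≤ε : ∀ x y → D x y ≤ ε x
    D≤ε = D≤ecc

    ε≤d : ∀ x → ε x ≤ d
    ε≤d = ecc≤diameter

    d≡⨆ε : d ≡ ⨆ ε
    d≡⨆ε = diameter≡⨆

    ε≡⨆D : ∀ x → ε x ≡ ⨆ (D x)
    ε≡⨆D = ecc≡⨆

    σ₂≡∑∑ε : σ₂ G ≡ ∑[ x < N ] ∑[ y < N ] (if (toℕ x <ᵇ toℕ y) ∧ G x y then ε x * ε y else 0)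
    σ₂≡∑∑ε = σ₂≡∑∑ G

  r : ℕ
  r = ⌈ d /2⌉

  origin : Fin N
  origin = proj₁ (⨆-attained ε)

  antipode : Fin N
  antipode = proj₁ (⨆-attained (D origin))

  D-origin-antipode : D origin antipode ≡ d
  D-origin-antipode = sym (begin
    d                  ≡⟨ d≡⨆ε ⟩
    ⨆ ε                ≡⟨ proj₂ (⨆-attained ε) ⟩
    ε origin           ≡⟨ ε≡⨆D origin ⟩
    ⨆ (D origin)       ≡⟨ proj₂ (⨆-attained (D origin)) ⟩
    D origin antipode  ∎)
    where open ≡-Reasoning

  a : Fin N → ℕ
  a = D origin

  b : Fin N → ℕ
  b = D antipode

  a≤ε : ∀ x → a x ≤ ε x
  a≤ε x = subst (_≤ ε x) (D-sym x origin) (D≤ε x origin)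

  b≤ε : ∀ x → b x ≤ ε x
  b≤ε x = subst (_≤ ε x) (D-sym x antipode) (D≤ε x antipode)

  a≤d : ∀ x → a x ≤ d
  a≤d x = ≤-trans (D≤ε origin x) (ε≤d origin)

  d≤a+b : ∀ x → d ≤ a x + b x
  d≤a+b x = subst₂ _≤_ D-origin-antipode (cong (a x +_) (D-sym x antipode)) (D-triangle origin x antipode)

  b-≥ : ∀ y {s} → s + a y ≤ d → s ≤ b y
  b-≥ y {s} s+ay≤d = +-cancelʳ-≤ (a y) s (b y) (≤-trans s+ay≤d (≤-trans (d≤a+b y) (≤-reflexive (+-comm (a y) (b y)))))

  a-≥ : ∀ y {s} → s + b y ≤ d → s ≤ a y
  a-≥ y {s} s+by≤d = +-cancelʳ-≤ (b y) s (a y) (≤-trans s+by≤d (d≤a+b y))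

  r≤ε : ∀ x → r ≤ ε x
  r≤ε x = ⌈/2⌉≤ (≤-trans (d≤a+b x) (+-mono-≤ (a≤ε x) (b≤ε x)))

  2r≤1+d : r + r ≤ suc d
  2r≤1+d = ⌈/2⌉+⌈/2⌉≤1+ d

  ρ : Fin N → ℕ
  ρ x = rank (a x) (b x)

  ρ-descends-towards-origin : ∀ {w x} → a w < a x → a x ≤ b x → ρ w < ρ x
  ρ-descends-towards-origin {w} = rank-<ˡ {α′ = a w} {β′ = b w}

  ρ-descends-towards-antipode : ∀ {w x} → b w < b x → b x ≤ a x → ρ w < ρ x
  ρ-descends-towards-antipode {w} = rank-<ʳ {α′ = a w} {β′ = b w}

  charge : Fin N → Fin N → ℕ
  charge x y = if G x y ∧ (ρ y <ᵇ ρ x) then ε x * ε y else 0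

  load : Fin N → ℕ
  load x = ∑[ y < N ] charge x y

  charge-lower-neighbour : ∀ {x y} → G x y ≡ true → ρ y < ρ x → charge x y ≡ ε x * ε y
  charge-lower-neighbour {x} {y} xy y<x rewrite xy | <⇒<ᵇ-true y<x = refl

  load-≥-neighbour : ∀ {x y} → G x y ≡ true → ρ y < ρ x → ε x * ε y ≤ load x
  load-≥-neighbour {x} {y} xy y<x =
    subst (_≤ load x) (charge-lower-neighbour xy y<x) (term≤∑ (charge x) y)

  load-≥-two-neighbours : ∀ {x y z} → y ≢ z → G x y ≡ true → ρ y < ρ x → G x z ≡ true → ρ z < ρ x →
                          ε x * ε y + ε x * ε z ≤ load x
  load-≥-two-neighbours {x} y≢z xy y<x xz z<x =
    subst (_≤ load x) (cong₂ _+_ (charge-lower-neighbour xy y<x) (charge-lower-neighbour xz z<x))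
          (two-terms≤∑ (charge x) y≢z)

  edgeTerm : Fin N → Fin N → ℕ
  edgeTerm x y = if (toℕ x <ᵇ toℕ y) ∧ G x y then ε x * ε y else 0

  charges≤edgeTerms : ∀ x y → charge x y + charge y x ≤ edgeTerm x y + edgeTerm y x
  charges≤edgeTerms x y with G x y in xy
  ... | false rewrite trans (IsSimple.sym simple y x) xy = z≤n
  ... | true  rewrite trans (IsSimple.sym simple y x) xy
                    | ∧-identityʳ (toℕ x <ᵇ toℕ y) | ∧-identityʳ (toℕ y <ᵇ toℕ x) | *-comm (ε y) (ε x) =
    ≤-trans (if-<ᵇ-exclusive (ρ x) (ρ y) (ε x * ε y)) (if-<ᵇ-exhaustive (ε x * ε y) x≢y)
    where
    x≢y : toℕ x ≢ toℕ y
    x≢y e with Fin.toℕ-injective e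
    ... | refl with trans (sym xy) (IsSimple.irref simple x)
    ...   | ()

  ∑load≤σ₂ : ∑[ x < N ] load x ≤ σ₂ G
  ∑load≤σ₂ = subst (∑[ x < N ] load x ≤_) (sym σ₂≡∑∑ε)
                   (∑∑-mono-≤-symmetrised charge edgeTerm charges≤edgeTerms)

  diametral : Walk d origin antipode
  diametral = subst (λ m → Walk m origin antipode) D-origin-antipode (shortest-walk origin antipode)

  path : ℕ → Fin N
  path = vertex diametral

  path-distances : ∀ {i} → i ≤ d → a (path i) ≡ i × b (path i) ≡ d ∸ i
  path-distances {i} i≤d = ≤-antisym a≤i i≤a , ≤-antisym b≤d∸i d∸i≤b
    where
    a≤i : a (path i) ≤ i
    a≤i = D-≤-walk (prefix diametral i≤d)
    b≤d∸i : b (path i) ≤ d ∸ i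
    b≤d∸i = subst (_≤ d ∸ i) (D-sym (path i) antipode) (D-≤-walk (suffix diametral i))
    i≤a : i ≤ a (path i)
    i≤a = a-≥ (path i) (≤-trans (+-monoʳ-≤ i b≤d∸i) (≤-reflexive (m+[n∸m]≡n i≤d)))
    d∸i≤b : d ∸ i ≤ b (path i)
    d∸i≤b = b-≥ (path i) (≤-trans (+-monoʳ-≤ (d ∸ i) a≤i) (≤-reflexive (m∸n+n≡m i≤d)))

  a-path : ∀ {i} → i ≤ d → a (path i) ≡ i
  a-path i≤d = proj₁ (path-distances i≤d)

  path-end : path d ≡ antipode
  path-end = sym (D≡0⇒≡ (trans (proj₂ (path-distances ≤-refl)) (n∸n≡0 d)))

  δ≤ε-path : ∀ {i} → i ≤ d → δ d i ≤ ε (path i)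
  δ≤ε-path {i} i≤d with path-distances i≤d
  ... | ai , bi = ⊔-lub (subst (_≤ ε (path i)) ai (a≤ε (path i))) (subst (_≤ ε (path i)) bi (b≤ε (path i)))

  ψ : ℕ → ℕ
  ψ i = ρ (path i)

  ψ-step-≢ : ∀ {i} → i < d → ψ i ≢ ψ (suc i)
  ψ-step-≢ {i} i<d e = rank-step-≢ i (d ∸ suc i) (trans (sym ψᵢ) (trans e ψᵢ₊₁))
    where
    ψᵢ : ψ i ≡ rank i (suc (d ∸ suc i))
    ψᵢ = cong₂ rank (a-path (<⇒≤ i<d)) (trans (proj₂ (path-distances (<⇒≤ i<d))) (+-∸-assoc 1 i<d))
    ψᵢ₊₁ : ψ (suc i) ≡ rank (suc i) (d ∸ suc i)
    ψᵢ₊₁ = cong₂ rank (a-path i<d) (proj₂ (path-distances i<d))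

  edgeWeight : ℕ → ℕ
  edgeWeight i = δ d i * δ d (suc i)

  -- incoming i and outgoing i are the weights δδ of the path edges u_{i-1}u_i and
  -- u_i u_{i+1}, counted only if the edge is charged to u_i.
  incoming : ℕ → ℕ
  incoming zero    = 0
  incoming (suc i) = if ψ i <ᵇ ψ (suc i) then edgeWeight i else 0

  outgoing : ℕ → ℕ
  outgoing i = if i <ᵇ d then (if ψ (suc i) <ᵇ ψ i then edgeWeight i else 0) else 0

  share : ℕ → ℕ
  share i = incoming i + outgoing i

  incoming≤charge : ∀ {i} → i < d → incoming (suc i) ≤ charge (path (suc i)) (path i)
  incoming≤charge {i} i<d rewrite trans (IsSimple.sym simple (path (suc i)) (path i)) (vertex-edge diametral i<d) =
    if-mono-≤ (ψ i <ᵇ ψ (suc i))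
      (≤-trans (≤-reflexive (*-comm (δ d i) (δ d (suc i)))) (*-mono-≤ (δ≤ε-path i<d) (δ≤ε-path (<⇒≤ i<d))))

  outgoing≤charge : ∀ {i} → i < d → outgoing i ≤ charge (path i) (path (suc i))
  outgoing≤charge {i} i<d rewrite <⇒<ᵇ-true i<d | vertex-edge diametral i<d =
    if-mono-≤ (ψ (suc i) <ᵇ ψ i) (*-mono-≤ (δ≤ε-path (<⇒≤ i<d)) (δ≤ε-path i<d))

  outgoing-≥d : ∀ {i} → d ≤ i → outgoing i ≡ 0
  outgoing-≥d d≤i rewrite ≥⇒<ᵇ-false d≤i = refl

  share≤load : ∀ {i} → i ≤ d → share i ≤ load (path i)
  share≤load {zero} _ with 0 <? d
  ... | yes 0<d = ≤-trans (outgoing≤charge 0<d) (term≤∑ (charge (path 0)) (path 1))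
  ... | no  0≮d = ≤-trans (≤-reflexive (outgoing-≥d (≮⇒≥ 0≮d))) z≤n
  share≤load {suc i} i<d with suc i <? d
  ... | yes i+1<d = ≤-trans (+-mono-≤ (incoming≤charge i<d) (outgoing≤charge i+1<d))
                            (two-terms≤∑ (charge (path (suc i))) path-i≢path-i+2)
    where
    path-i≢path-i+2 : path i ≢ path (suc (suc i))
    path-i≢path-i+2 e = <⇒≢ (m<n⇒m<1+n (n<1+n i))
                              (trans (sym (a-path (<⇒≤ i<d))) (trans (cong a e) (a-path i+1<d)))
  ... | no  i+1≮d = begin
    incoming (suc i) + outgoing (suc i)  ≡⟨ cong (incoming (suc i) +_) (outgoing-≥d (≮⇒≥ i+1≮d)) ⟩
    incoming (suc i) + 0                 ≡⟨ +-identityʳ _ ⟩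
    incoming (suc i)                     ≤⟨ incoming≤charge i<d ⟩
    charge (path (suc i)) (path i)       ≤⟨ term≤∑ (charge (path (suc i))) (path i) ⟩
    load (path (suc i))                  ∎
    where open ≤-Reasoning

  onPath : Fin N → Bool
  onPath x = x == path (a x)

  onPath-origin : onPath origin ≡ true
  onPath-origin rewrite D-self origin = ==-refl origin

  onPath-antipode : onPath antipode ≡ true
  onPath-antipode = subst (λ i → antipode == path i ≡ true) (sym D-origin-antipode)
                          (subst (λ y → antipode == y ≡ true) (sym path-end) (==-refl antipode))

  off-path-a≢0 : ∀ {x} → onPath x ≡ false → a x ≢ 0
  off-path-a≢0 off ax≡0 with D≡0⇒≡ ax≡0
  ... | refl with trans (sym off) onPath-origin
  ...   | ()

  off-path-b≢0 : ∀ {x} → onPath x ≡ false → b x ≢ 0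
  off-path-b≢0 off bx≡0 with D≡0⇒≡ bx≡0
  ... | refl with trans (sym off) onPath-antipode
  ...   | ()

  one-lower-neighbour : ∀ {x w} → G x w ≡ true → ρ w < ρ x →
                        (suc r ≤ ε x × r ≤ ε w) ⊎ (r ≤ ε x × suc r ≤ ε w) → r * (r + 1) ≤ load x
  one-lower-neighbour xw w<x large = ≤-trans (r*[r+1]≤ large) (load-≥-neighbour xw w<x)

  two-lower-neighbours : ∀ {x w w′} → 1 ≤ r → w ≢ w′ → G x w ≡ true → ρ w < ρ x →
                         G x w′ ≡ true → ρ w′ < ρ x → r * (r + 1) ≤ load x
  two-lower-neighbours {x} {w} {w′} 1≤r w≢w′ xw w<x xw′ w′<x = begin
    r * (r + 1)          ≤⟨ r*[r+1]≤r*r+r*r 1≤r ⟩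
    r * r + r * r        ≤⟨ +-mono-≤ (*-mono-≤ (r≤ε x) (r≤ε w)) (*-mono-≤ (r≤ε x) (r≤ε w′)) ⟩
    ε x * ε w + ε x * ε w′ ≤⟨ load-≥-two-neighbours w≢w′ xw w<x xw′ w′<x ⟩
    load x               ∎
    where open ≤-Reasoning

  -- a x = b x = r: both neighbours towards the two ends have lower rank.
  balanced-load : ∀ x {α w} → a x ≡ suc α → b x ≡ suc α → r ≡ suc α → G x w ≡ true → a w ≡ α →
                  r * (r + 1) ≤ load x
  balanced-load x {α} {w} ax bx r≡1+α xw aw with predecessor antipode x bx
  ... | w′ , xw′ , bw′ = two-lower-neighbours (subst (1 ≤_) (sym r≡1+α) (s≤s z≤n)) w≢w′ xw w<x xw′ w′<x
    where
    w<x : ρ w < ρ x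
    w<x = ρ-descends-towards-origin (≤-reflexive (trans (cong suc aw) (sym ax))) (≤-reflexive (trans ax (sym bx)))
    w′<x : ρ w′ < ρ x
    w′<x = ρ-descends-towards-antipode (≤-reflexive (trans (cong suc bw′) (sym bx))) (≤-reflexive (trans bx (sym ax)))
    w≢w′ : w ≢ w′
    w≢w′ refl = 1+n≰n (begin
      suc (suc (α + α))  ≡⟨ cong suc (sym (+-suc α α)) ⟩
      suc α + suc α      ≡⟨ cong₂ _+_ (sym r≡1+α) (sym r≡1+α) ⟩
      r + r              ≤⟨ 2r≤1+d ⟩
      suc d              ≤⟨ s≤s (≤-trans (d≤a+b w) (≤-reflexive (cong₂ _+_ aw bw′))) ⟩
      suc (α + α)        ∎)
      where open ≤-Reasoning

  -- Unless a x = b x = r, one of x and w is at distance at least r + 1 from the antipode.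
  load-nearer-origin : ∀ x {α w} → a x ≡ suc α → a x ≤ b x → G x w ≡ true → a w ≡ α →
                       r * (r + 1) ≤ load x
  load-nearer-origin x {α} {w} ax ax≤bx xw aw = cases (suc r ≤? b x) (suc (α + r) ≤? d)
    where
    w<x : ρ w < ρ x
    w<x = ρ-descends-towards-origin (≤-reflexive (trans (cong suc aw) (sym ax))) ax≤bx
    cases : Dec (suc r ≤ b x) → Dec (suc (α + r) ≤ d) → r * (r + 1) ≤ load x
    cases (yes r<bx) _ = one-lower-neighbour xw w<x (inj₁ (≤-trans r<bx (b≤ε x) , r≤ε w))
    cases (no _) (yes α+r<d) = one-lower-neighbour xw w<x (inj₂ (r≤ε x , ≤-trans (b-≥ w r+1+aw≤d) (b≤ε w)))
      where
      r+1+aw≤d : suc r + a w ≤ d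
      r+1+aw≤d = subst (_≤ d) (cong suc (trans (+-comm α r) (cong (r +_) (sym aw)))) α+r<d
    cases (no r≮bx) (no α+r≮d) = balanced-load x ax bx≡1+α r≡1+α xw aw
      where
      bx≤r : b x ≤ r
      bx≤r = s≤s⁻¹ (≰⇒> r≮bx)
      r≡1+α : r ≡ suc α
      r≡1+α = ≤-antisym (+-cancelʳ-≤ r r (suc α) (≤-trans 2r≤1+d (s≤s (s≤s⁻¹ (≰⇒> α+r≮d)))))
                        (≤-trans (≤-reflexive (sym ax)) (≤-trans ax≤bx bx≤r))
      bx≡1+α : b x ≡ suc α
      bx≡1+α = ≤-antisym (≤-trans bx≤r (≤-reflexive r≡1+α)) (≤-trans (≤-reflexive (sym ax)) ax≤bx)

  load-nearer-antipode : ∀ x {β w} → b x ≡ suc β → b x < a x → G x w ≡ true → b w ≡ β →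
                         r * (r + 1) ≤ load x
  load-nearer-antipode x {β} {w} bx bx<ax xw bw = cases (suc r ≤? a x)
    where
    w<x : ρ w < ρ x
    w<x = ρ-descends-towards-antipode (≤-reflexive (trans (cong suc bw) (sym bx))) (<⇒≤ bx<ax)
    cases : Dec (suc r ≤ a x) → r * (r + 1) ≤ load x
    cases (yes r<ax) = one-lower-neighbour xw w<x (inj₁ (≤-trans r<ax (a≤ε x) , r≤ε w))
    cases (no r≮ax)  = one-lower-neighbour xw w<x (inj₂ (r≤ε x , ≤-trans (a-≥ w r+1+bw≤d) (a≤ε w)))
      where
      2+β≤r : suc (suc β) ≤ r
      2+β≤r = ≤-trans (subst (_< a x) bx bx<ax) (s≤s⁻¹ (≰⇒> r≮ax))
      r+1+bw≤d : suc r + b w ≤ d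
      r+1+bw≤d = s≤s⁻¹ (begin
        suc (suc r + b w)      ≡⟨ cong (λ t → suc (suc (r + t))) bw ⟩
        suc (suc (r + β))      ≡⟨ sym (trans (+-suc r (suc β)) (cong suc (+-suc r β))) ⟩
        r + suc (suc β)        ≤⟨ +-monoʳ-≤ r 2+β≤r ⟩
        r + r                  ≤⟨ 2r≤1+d ⟩
        suc d                  ∎)
        where open ≤-Reasoning

  off-path-load : ∀ x → onPath x ≡ false → r * (r + 1) ≤ load x
  off-path-load x off with a x ≤? b x
  ... | yes ax≤bx with predecessor origin x (≢0⇒≡suc-pred (off-path-a≢0 off))
  ...   | w , xw , aw = load-nearer-origin x (≢0⇒≡suc-pred (off-path-a≢0 off)) ax≤bx xw aw
  off-path-load x off | no ax≰bx with predecessor antipode x (≢0⇒≡suc-pred (off-path-b≢0 off))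
  ...   | w , xw , bw = load-nearer-antipode x (≢0⇒≡suc-pred (off-path-b≢0 off)) (≰⇒> ax≰bx) xw bw

  share-or-r*[r+1]≤load : ∀ x → (if onPath x then share (a x) else r * (r + 1)) ≤ load x
  share-or-r*[r+1]≤load x with onPath x in on
  ... | true  = subst (λ y → share (a x) ≤ load y) (sym (==-true⇒≡ x _ on)) (share≤load (a≤d x))
  ... | false = off-path-load x on

  ∑-on-path : (F : ℕ → ℕ) → ∑[ x < N ] (if onPath x then F (a x) else 0) ≡ ∑[ i < suc d ] F (toℕ i)
  ∑-on-path = ∑-over-section path a (λ i<1+d → a-path (s≤s⁻¹ i<1+d)) (λ x → s≤s (a≤d x))

  ∑-off-path : ∀ c → ∑[ x < N ] (if onPath x then 0 else c) ≡ (N ∸ suc d) * c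
  ∑-off-path c = begin
    off                        ≡⟨ sym (m+n∸n≡m off on) ⟩
    off + on ∸ on              ≡⟨ cong (_∸ on) all ⟩
    N * c ∸ on                 ≡⟨ cong (N * c ∸_) (trans (∑-on-path (λ _ → c)) (∑-const (suc d) c)) ⟩
    N * c ∸ suc d * c          ≡⟨ sym (*-distribʳ-∸ c N (suc d)) ⟩
    (N ∸ suc d) * c            ∎
    where
    open ≡-Reasoning
    off on : ℕ
    off = ∑[ x < N ] (if onPath x then 0 else c)
    on  = ∑[ x < N ] (if onPath x then c else 0)
    complement : ∀ x → (if onPath x then 0 else c) + (if onPath x then c else 0) ≡ c
    complement x with onPath x
    ... | true  = refl
    ... | false = +-identityʳ c
    all : off + on ≡ N * c
    all = trans (sym (∑-distrib-+ (λ x → if onPath x then 0 else c) (λ x → if onPath x then c else 0)))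
                (trans (sum-cong-≗ complement) (∑-const N c))

  g₂≤∑share : g₂ d ≤ ∑[ i < suc d ] share (toℕ i)
  g₂≤∑share = begin
    g₂ d
      ≡⟨ g₂≡∑ d ⟩
    ∑[ i < d ] edgeWeight (toℕ i)
      ≤⟨ ∑-mono-≤ (λ i → edge-charged (Fin.toℕ<n i)) ⟩
    ∑[ i < d ] (incoming (suc (toℕ i)) + outgoing (toℕ i))
      ≡⟨ ∑-distrib-+ {d} (λ i → incoming (suc (toℕ i))) (λ i → outgoing (toℕ i)) ⟩
    ∑[ i < suc d ] incoming (toℕ i) + ∑[ i < d ] outgoing (toℕ i)
      ≡⟨ cong (∑[ i < suc d ] incoming (toℕ i) +_) outgoing-sum ⟩
    ∑[ i < suc d ] incoming (toℕ i) + ∑[ i < suc d ] outgoing (toℕ i)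
      ≡⟨ sym (∑-distrib-+ {suc d} (λ i → incoming (toℕ i)) (λ i → outgoing (toℕ i))) ⟩
    ∑[ i < suc d ] share (toℕ i)
      ∎
    where
    open ≤-Reasoning
    edge-charged : ∀ {i} → i < d → edgeWeight i ≤ incoming (suc i) + outgoing i
    edge-charged {i} i<d rewrite <⇒<ᵇ-true i<d = if-<ᵇ-exhaustive (edgeWeight i) (ψ-step-≢ i<d)
    outgoing-sum : ∑[ i < d ] outgoing (toℕ i) ≡ ∑[ i < suc d ] outgoing (toℕ i)
    outgoing-sum = sym (trans (∑-snoc d outgoing)
                              (trans (cong (∑[ i < d ] outgoing (toℕ i) +_) (outgoing-≥d ≤-refl)) (+-identityʳ _)))

  bound≤σ₂ : bound N d ≤ σ₂ G
  bound≤σ₂ = begin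
    g₂ d + (N ∸ 1 ∸ d) * m                                        ≡⟨ cong (λ k → g₂ d + k * m) (∸-+-assoc N 1 d) ⟩
    g₂ d + (N ∸ suc d) * m                                        ≤⟨ +-monoˡ-≤ _ g₂≤∑share ⟩
    ∑[ i < suc d ] share (toℕ i) + (N ∸ suc d) * m
      ≡⟨ cong₂ _+_ (sym (∑-on-path share)) (sym (∑-off-path m)) ⟩
    ∑[ x < N ] (if onPath x then share (a x) else 0) + ∑[ x < N ] (if onPath x then 0 else m)
      ≡⟨ sym (∑-distrib-+ {N} (λ x → if onPath x then share (a x) else 0) (λ x → if onPath x then 0 else m)) ⟩
    ∑[ x < N ] ((if onPath x then share (a x) else 0) + (if onPath x then 0 else m))
      ≡⟨ sum-cong-≗ {N} (λ x → sym (if-split (onPath x) (share (a x)) m)) ⟩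
    ∑[ x < N ] (if onPath x then share (a x) else m)               ≤⟨ ∑-mono-≤ share-or-r*[r+1]≤load ⟩
    ∑[ x < N ] load x                                             ≤⟨ ∑load≤σ₂ ⟩
    σ₂ G                                                          ∎
    where
    open ≤-Reasoning
    m : ℕ
    m = r * (r + 1)

σ₂-lower-bound : ∀ n .{{_ : NonZero n}} (G : Graph n) → IsSimple G → Connected G → bound n (diameter G) ≤ σ₂ G
σ₂-lower-bound (suc n₁) G simple connected =
  subst (λ d → bound (suc n₁) d ≤ σ₂ G) d≡diameter bound≤σ₂
  where open LowerBound G simple connected

-- The extremal tree

module ExtremalTree (n d j : ℕ) (d<n : suc d ≤ n) (2≤d⊎n≡1+d : 2 ≤ d ⊎ n ≡ suc d) (j≤d : j ≤ d)
                    (δj≡r : j ⊔ (d ∸ j) ≡ ⌈ d /2⌉) where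

  T : Graph n
  T = extremalTree n d j

  r : ℕ
  r = ⌈ d /2⌉

  -- The adjacency of extremalTree on indices; Defs keeps it private, but
  -- T u v is definitionally adjacent (toℕ u) (toℕ v).
  adjacent : ℕ → ℕ → Bool
  adjacent x y = (not (d <ᵇ x) ∧ not (d <ᵇ y) ∧ ((suc x ≡ᵇ y) ∨ (suc y ≡ᵇ x)))
                 ∨ ((d <ᵇ x) ∧ (y ≡ᵇ j))
                 ∨ ((d <ᵇ y) ∧ (x ≡ᵇ j))

  data TreeEdge : ℕ → ℕ → Set where
    path-forward  : ∀ {x} → suc x ≤ d → TreeEdge x (suc x)
    path-backward : ∀ {x} → suc x ≤ d → TreeEdge (suc x) x
    leaf-out      : ∀ {y} → d < y → TreeEdge y j
    leaf-in       : ∀ {y} → d < y → TreeEdge j y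

  adjacent⇒TreeEdge : ∀ x y → adjacent x y ≡ true → TreeEdge x y
  adjacent⇒TreeEdge x y e with d <ᵇ x in dx | d <ᵇ y in dy
  ... | true | _ with ∨-true⁻ (y ≡ᵇ j) _ e
  ...   | inj₁ y≡j = subst (TreeEdge x) (sym (≡ᵇ-true⇒≡ y j y≡j)) (leaf-out (<ᵇ-true⇒< d x dx))
  ...   | inj₂ leafIn with ∧-true⁻ _ _ leafIn
  ...     | d<y , x≡j =
    subst (λ z → TreeEdge z y) (sym (≡ᵇ-true⇒≡ x j x≡j)) (leaf-in (<ᵇ-true⇒< d y (trans dy d<y)))
  adjacent⇒TreeEdge x y e | false | true =
    subst (λ z → TreeEdge z y) (sym (≡ᵇ-true⇒≡ x j e)) (leaf-in (<ᵇ-true⇒< d y dy))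
  adjacent⇒TreeEdge x y e | false | false with ∨-true⁻ ((suc x ≡ᵇ y) ∨ (suc y ≡ᵇ x)) false e
  ... | inj₁ consecutive with ∨-true⁻ (suc x ≡ᵇ y) _ consecutive
  ...   | inj₁ y≡x+1 = subst (TreeEdge x) (≡ᵇ-true⇒≡ (suc x) y y≡x+1)
                             (path-forward (subst (_≤ d) (sym (≡ᵇ-true⇒≡ (suc x) y y≡x+1)) (<ᵇ-false⇒≥ d y dy)))
  ...   | inj₂ x≡y+1 = subst (λ z → TreeEdge z y) (≡ᵇ-true⇒≡ (suc y) x x≡y+1)
                             (path-backward (subst (_≤ d) (sym (≡ᵇ-true⇒≡ (suc y) x x≡y+1)) (<ᵇ-false⇒≥ d x dx)))

  TreeEdge⇒adjacent : ∀ {x y} → TreeEdge x y → adjacent x y ≡ true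
  TreeEdge⇒adjacent {x} (path-forward x<d)
    rewrite ≥⇒<ᵇ-false (<⇒≤ x<d) | ≥⇒<ᵇ-false x<d = ∨-trueˡ _ (∨-trueˡ _ (≡ᵇ-refl (suc x)))
  TreeEdge⇒adjacent {_} {y} (path-backward y<d)
    rewrite ≥⇒<ᵇ-false y<d | ≥⇒<ᵇ-false (<⇒≤ y<d) = ∨-trueˡ _ (∨-trueʳ (suc (suc y) ≡ᵇ y) (≡ᵇ-refl (suc y)))
  TreeEdge⇒adjacent (leaf-out d<y) rewrite <⇒<ᵇ-true d<y = ∨-trueˡ _ (≡ᵇ-refl j)
  TreeEdge⇒adjacent (leaf-in d<y) rewrite <⇒<ᵇ-true d<y | ≥⇒<ᵇ-false j≤d = ≡ᵇ-refl j

  TreeEdge-sym : ∀ {x y} → TreeEdge x y → TreeEdge y x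
  TreeEdge-sym (path-forward x<d)  = path-backward x<d
  TreeEdge-sym (path-backward y<d) = path-forward y<d
  TreeEdge-sym (leaf-out d<y)      = leaf-in d<y
  TreeEdge-sym (leaf-in d<y)       = leaf-out d<y

  TreeEdge-irrefl : ∀ {x} → TreeEdge x x → ⊥
  TreeEdge-irrefl (leaf-out d<j) = <⇒≱ d<j j≤d
  TreeEdge-irrefl (leaf-in d<j)  = <⇒≱ d<j j≤d

  adjacent-sym : ∀ x y → adjacent x y ≡ adjacent y x
  adjacent-sym x y with adjacent x y in xy | adjacent y x in yx
  ... | true  | true  = refl
  ... | false | false = refl
  ... | true  | false with trans (sym yx) (TreeEdge⇒adjacent (TreeEdge-sym (adjacent⇒TreeEdge x y xy)))
  ...   | ()
  adjacent-sym x y | false | true with trans (sym xy) (TreeEdge⇒adjacent (TreeEdge-sym (adjacent⇒TreeEdge y x yx)))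
  ...   | ()

  adjacent-irrefl : ∀ x → adjacent x x ≡ false
  adjacent-irrefl x with adjacent x x in xx
  ... | true  = ⊥-elim (TreeEdge-irrefl (adjacent⇒TreeEdge x x xx))
  ... | false = refl

  simple : IsSimple T
  simple = record { sym = λ u v → adjacent-sym (toℕ u) (toℕ v) ; irref = λ u → adjacent-irrefl (toℕ u) }

  open Walks T

  edge : ∀ {u w : Fin n} → TreeEdge (toℕ u) (toℕ w) → T u w ≡ true
  edge = TreeEdge⇒adjacent

  pathVertex : ∀ {i} → i ≤ d → Fin n
  pathVertex i≤d = fromℕ< (≤-<-trans i≤d d<n)

  toℕ-pathVertex : ∀ {i} (i≤d : i ≤ d) → toℕ (pathVertex i≤d) ≡ i
  toℕ-pathVertex i≤d = Fin.toℕ-fromℕ< (≤-<-trans i≤d d<n)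

  u₀ : Fin n
  u₀ = pathVertex z≤n

  uⱼ : Fin n
  uⱼ = pathVertex j≤d

  path-walk : ∀ t {u v} → toℕ u + t ≡ toℕ v → toℕ v ≤ d → Walk t u v
  path-walk zero    {u} {v} u≡v _ = subst (Walk 0 u) (Fin.toℕ-injective (trans (sym (+-identityʳ (toℕ u))) u≡v)) here
  path-walk (suc t) {u} {v} u+t+1≡v v≤d =
    step {w = w} (edge (subst (TreeEdge (toℕ u)) (sym toℕ-w) (path-forward u+1≤d)))
         (path-walk t (trans (cong (_+ t) toℕ-w) (trans (sym (+-suc (toℕ u) t)) u+t+1≡v)) v≤d)
    where
    u+1≤d : suc (toℕ u) ≤ d
    u+1≤d = ≤-trans (s≤s (m≤m+n (toℕ u) t)) (≤-trans (≤-reflexive (trans (sym (+-suc (toℕ u) t)) u+t+1≡v)) v≤d)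
    w : Fin n
    w = pathVertex u+1≤d
    toℕ-w : toℕ w ≡ suc (toℕ u)
    toℕ-w = toℕ-pathVertex u+1≤d

  walk-from-u₀ : ∀ u → ∃ λ m → Walk m u₀ u
  walk-from-u₀ u with toℕ u ≤? d
  ... | yes u≤d = toℕ u , path-walk (toℕ u) (cong (_+ toℕ u) (toℕ-pathVertex z≤n)) u≤d
  ... | no  u≰d = suc j , snoc (path-walk j (trans (cong (_+ j) (toℕ-pathVertex z≤n)) (sym (toℕ-pathVertex j≤d))) uⱼ≤d)
                               (edge (subst (λ z → TreeEdge z (toℕ u)) (sym (toℕ-pathVertex j≤d)) (leaf-in (≰⇒> u≰d))))
    where
    uⱼ≤d : toℕ uⱼ ≤ d
    uⱼ≤d = subst (_≤ d) (sym (toℕ-pathVertex j≤d)) j≤d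

  connected : Connected T
  connected u v with walk-from-u₀ u | walk-from-u₀ v
  ... | m , p | m′ , q = m + m′ , walk≤-complete (m + m′) (reverse (IsSimple.sym simple) p ++ʷ q) ≤-refl

  open Distance T simple connected

  D-along-path : ∀ t {u v} → toℕ u + t ≡ toℕ v → toℕ v ≤ d → D u v ≤ t
  D-along-path t u+t≡v v≤d = D-≤-walk (path-walk t u+t≡v v≤d)

  D-path-≤ : ∀ {u v} → toℕ u ≤ d → toℕ v ≤ d → D u v ≤ (toℕ v ∸ toℕ u) ⊔ (toℕ u ∸ toℕ v)
  D-path-≤ {u} {v} u≤d v≤d with toℕ u ≤? toℕ v
  ... | yes u≤v = ≤-trans (D-along-path (toℕ v ∸ toℕ u) (m+[n∸m]≡n u≤v) v≤d) (m≤m⊔n _ _)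
  ... | no  u≰v = ≤-trans (subst (_≤ toℕ u ∸ toℕ v) (D-sym v u)
                                 (D-along-path (toℕ u ∸ toℕ v) (m+[n∸m]≡n v≤u) u≤d))
                          (m≤n⊔m _ _)
    where
    v≤u : toℕ v ≤ toℕ u
    v≤u = <⇒≤ (≰⇒> u≰v)

  uⱼ-index : toℕ uⱼ ≡ j
  uⱼ-index = toℕ-pathVertex j≤d

  uⱼ≤d : toℕ uⱼ ≤ d
  uⱼ≤d = subst (_≤ d) (sym uⱼ-index) j≤d

  leaf⇒2≤d : ∀ (y : Fin n) → d < toℕ y → 2 ≤ d
  leaf⇒2≤d y d<y =
    [ (λ 2≤d → 2≤d) , (λ n≡1+d → ⊥-elim (<⇒≱ d<y (s≤s⁻¹ (subst (toℕ y <_) n≡1+d (Fin.toℕ<n y))))) ]′ 2≤d⊎n≡1+d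

  j≤r : j ≤ r
  j≤r = subst (j ≤_) δj≡r (m≤m⊔n j (d ∸ j))

  j<d : 2 ≤ d → suc j ≤ d
  j<d 2≤d = ≤-trans (s≤s j≤r) (⌈/2⌉< 2≤d)

  1≤j : 2 ≤ d → 1 ≤ j
  1≤j 2≤d = n≢0⇒n>0 λ j≡0 →
    <⇒≱ (⌈/2⌉< 2≤d) (≤-reflexive (trans (cong (λ i → i ⊔ (d ∸ i)) (sym j≡0)) δj≡r))

  -- The leaves hang at u_j, so they are no farther from a path vertex than the
  -- farther end of the path.
  D-uⱼ<δ : ∀ x → toℕ x ≤ d → 2 ≤ d → suc (D x uⱼ) ≤ δ d (toℕ x)
  D-uⱼ<δ x x≤d 2≤d with toℕ x ≤? j
  ... | yes x≤j = begin
    suc (D x uⱼ)              ≤⟨ s≤s (D-along-path (j ∸ toℕ x) (trans (m+[n∸m]≡n x≤j) (sym uⱼ-index)) uⱼ≤d) ⟩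
    suc (j ∸ toℕ x)           ≡⟨ sym (+-∸-assoc 1 x≤j) ⟩
    suc j ∸ toℕ x             ≤⟨ ∸-monoˡ-≤ (toℕ x) (j<d 2≤d) ⟩
    d ∸ toℕ x                 ≤⟨ m≤n⊔m (toℕ x) (d ∸ toℕ x) ⟩
    δ d (toℕ x)               ∎
    where open ≤-Reasoning
  ... | no  x≰j = begin
    suc (D x uⱼ)              ≡⟨ cong suc (D-sym x uⱼ) ⟩
    suc (D uⱼ x)              ≤⟨ s≤s (D-along-path (toℕ x ∸ j) uⱼ+[x∸j]≡x x≤d) ⟩
    suc (toℕ x ∸ j)           ≡⟨ +-comm 1 (toℕ x ∸ j) ⟩
    toℕ x ∸ j + 1             ≤⟨ +-monoʳ-≤ (toℕ x ∸ j) (1≤j 2≤d) ⟩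
    toℕ x ∸ j + j             ≡⟨ m∸n+n≡m j≤x ⟩
    toℕ x                     ≤⟨ m≤m⊔n (toℕ x) (d ∸ toℕ x) ⟩
    δ d (toℕ x)               ∎
    where
    open ≤-Reasoning
    j≤x : j ≤ toℕ x
    j≤x = <⇒≤ (≰⇒> x≰j)
    uⱼ+[x∸j]≡x : toℕ uⱼ + (toℕ x ∸ j) ≡ toℕ x
    uⱼ+[x∸j]≡x = trans (cong (_+ (toℕ x ∸ j)) uⱼ-index) (m+[n∸m]≡n j≤x)

  D-from-path : ∀ x → toℕ x ≤ d → ∀ y → D x y ≤ δ d (toℕ x)
  D-from-path x x≤d y with toℕ y ≤? d
  ... | yes y≤d = ≤-trans (D-path-≤ x≤d y≤d) (⊔-lub (≤-trans (∸-monoˡ-≤ (toℕ x) y≤d) (m≤n⊔m (toℕ x) _))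
                                                  (≤-trans (m∸n≤m (toℕ x) (toℕ y)) (m≤m⊔n (toℕ x) _)))
  ... | no  y≰d = begin
    D x y              ≤⟨ D-triangle x uⱼ y ⟩
    D x uⱼ + D uⱼ y    ≤⟨ +-monoʳ-≤ (D x uⱼ) (D-edge uⱼy) ⟩
    D x uⱼ + 1         ≡⟨ +-comm (D x uⱼ) 1 ⟩
    suc (D x uⱼ)       ≤⟨ D-uⱼ<δ x x≤d (leaf⇒2≤d y (≰⇒> y≰d)) ⟩
    δ d (toℕ x)        ∎
    where
    open ≤-Reasoning
    uⱼy : T uⱼ y ≡ true
    uⱼy = edge (subst (λ z → TreeEdge z (toℕ y)) (sym uⱼ-index) (leaf-in (≰⇒> y≰d)))

  D-from-leaf : ∀ x → d < toℕ x → ∀ y → D x y ≤ suc r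
  D-from-leaf x d<x y = ≤-trans (D-triangle x uⱼ y) (+-mono-≤ (D-edge xuⱼ) uⱼy≤r)
    where
    xuⱼ : T x uⱼ ≡ true
    xuⱼ = edge (subst (TreeEdge (toℕ x)) (sym uⱼ-index) (leaf-out d<x))
    uⱼy≤r : D uⱼ y ≤ r
    uⱼy≤r = ≤-trans (D-from-path uⱼ uⱼ≤d y) (≤-reflexive (trans (cong (δ d) uⱼ-index) δj≡r))

  eccBound : ℕ → ℕ
  eccBound x = if d <ᵇ x then suc r else δ d x

  ecc≤eccBound : ∀ x → ecc T x ≤ eccBound (toℕ x)
  ecc≤eccBound x = subst (_≤ eccBound (toℕ x)) (sym (ecc≡⨆ x)) (⨆-least (D x) D≤eccBound)
    where
    D≤eccBound : ∀ y → D x y ≤ eccBound (toℕ x)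
    D≤eccBound y with d <ᵇ toℕ x in leaf
    ... | true  = D-from-leaf x (<ᵇ-true⇒< d (toℕ x) leaf) y
    ... | false = D-from-path x (<ᵇ-false⇒≥ d (toℕ x) leaf) y

  eccBound≤d : ∀ x → eccBound (toℕ x) ≤ d
  eccBound≤d x with d <ᵇ toℕ x in leaf
  ... | true  = ⌈/2⌉< (leaf⇒2≤d x (<ᵇ-true⇒< d (toℕ x) leaf))
  ... | false = ⊔-lub (<ᵇ-false⇒≥ d (toℕ x) leaf) (m∸n≤m d (toℕ x))

  -- The projection onto the path; being 1-Lipschitz along edges, it bounds distances from below.
  position : ℕ → ℕ
  position x = if d <ᵇ x then j else x

  position-edge : ∀ {x y} → TreeEdge x y → position y ≤ suc (position x)
  position-edge {x} (path-forward x<d) rewrite ≥⇒<ᵇ-false (<⇒≤ x<d) | ≥⇒<ᵇ-false x<d = ≤-refl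
  position-edge {_} {y} (path-backward y<d) rewrite ≥⇒<ᵇ-false y<d | ≥⇒<ᵇ-false (<⇒≤ y<d) = m≤n⇒m≤1+n (n≤1+n y)
  position-edge (leaf-out d<y) rewrite <⇒<ᵇ-true d<y | ≥⇒<ᵇ-false j≤d = n≤1+n j
  position-edge (leaf-in d<y) rewrite <⇒<ᵇ-true d<y | ≥⇒<ᵇ-false j≤d = n≤1+n j

  position-walk : ∀ {m u v} → Walk m u v → position (toℕ v) ≤ position (toℕ u) + m
  position-walk here = ≤-reflexive (sym (+-identityʳ _))
  position-walk {suc m} {u} {v} (step {w = w} uw p) = begin
    position (toℕ v)              ≤⟨ position-walk p ⟩
    position (toℕ w) + m          ≤⟨ +-monoˡ-≤ m (position-edge (adjacent⇒TreeEdge (toℕ u) (toℕ w) uw)) ⟩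
    suc (position (toℕ u)) + m    ≡⟨ sym (+-suc (position (toℕ u)) m) ⟩
    position (toℕ u) + suc m      ∎
    where open ≤-Reasoning

  diameter≡d : diameter T ≡ d
  diameter≡d = ≤-antisym diameter≤d (≤-trans d≤D (≤-trans (D≤ecc u₀ u_d) (ecc≤diameter u₀)))
    where
    diameter≤d : diameter T ≤ d
    diameter≤d = subst (_≤ d) (sym diameter≡⨆) (⨆-least (ecc T) (λ x → ≤-trans (ecc≤eccBound x) (eccBound≤d x)))
    u_d : Fin n
    u_d = pathVertex ≤-refl
    d≤D : d ≤ D u₀ u_d
    d≤D = subst₂ (λ s t → s ≤ t + D u₀ u_d)
                 (trans (cong position (toℕ-pathVertex ≤-refl)) (cong (λ b → if b then j else d) (≥⇒<ᵇ-false {d} ≤-refl)))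
                 (cong position (toℕ-pathVertex z≤n))
                 (position-walk (shortest-walk u₀ u_d))

  eccBound-j : eccBound j ≡ r
  eccBound-j rewrite ≥⇒<ᵇ-false j≤d = δj≡r

  eccBound-path : ∀ {x} → x ≤ d → eccBound x ≡ δ d x
  eccBound-path x≤d rewrite ≥⇒<ᵇ-false x≤d = refl

  edgeBound : ℕ → ℕ → ℕ
  edgeBound x y = if (x <ᵇ y) ∧ adjacent x y then eccBound x * eccBound y else 0

  pathTerm : ℕ → ℕ → ℕ
  pathTerm x y = if y ≡ᵇ suc x then (if x <ᵇ d then eccBound x * eccBound (suc x) else 0) else 0

  leafTerm : ℕ → ℕ → ℕ
  leafTerm x y = if x ≡ᵇ j then (if d <ᵇ y then r * suc r else 0) else 0

  pathTerm-non-edge : ∀ x y → ((x <ᵇ y) ∧ adjacent x y) ≡ false → pathTerm x y ≡ 0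
  pathTerm-non-edge x y non-edge with y ≟ suc x | x <? d
  ... | no y≢x+1 | _ rewrite ≢⇒≡ᵇ-false y (suc x) y≢x+1 = refl
  ... | yes refl | no x≮d rewrite ≥⇒<ᵇ-false (≮⇒≥ x≮d) = if-zero (suc x ≡ᵇ suc x)
  ... | yes refl | yes x<d
    with trans (sym non-edge) (∧-true⁺ (<⇒<ᵇ-true (n<1+n x)) (TreeEdge⇒adjacent (path-forward x<d)))
  ...   | ()

  leafTerm-non-edge : ∀ x y → ((x <ᵇ y) ∧ adjacent x y) ≡ false → leafTerm x y ≡ 0
  leafTerm-non-edge x y non-edge with x ≟ j | d <? y
  ... | no x≢j | _ rewrite ≢⇒≡ᵇ-false x j x≢j = refl
  ... | yes refl | no d≮y rewrite ≥⇒<ᵇ-false (≮⇒≥ d≮y) = if-zero (x ≡ᵇ x)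
  ... | yes refl | yes d<y
    with trans (sym non-edge) (∧-true⁺ (<⇒<ᵇ-true (≤-<-trans j≤d d<y)) (TreeEdge⇒adjacent (leaf-in d<y)))
  ...   | ()

  split-path-edge : ∀ {x} → suc x ≤ d → eccBound x * eccBound (suc x) ≡ pathTerm x (suc x) + leafTerm x (suc x)
  split-path-edge {x} x<d rewrite ≡ᵇ-refl x | <⇒<ᵇ-true x<d | ≥⇒<ᵇ-false {d} x<d | if-zero (x ≡ᵇ j) =
    sym (+-identityʳ _)

  split-leaf-edge : ∀ {y} → d < y → eccBound j * eccBound y ≡ pathTerm j y + leafTerm j y
  split-leaf-edge {y} d<y = begin
    eccBound j * eccBound y        ≡⟨ cong₂ _*_ eccBound-j eccBound-leaf ⟩
    r * suc r                      ≡⟨ sym leafTerm-leaf ⟩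
    leafTerm j y                   ≡⟨ cong (_+ leafTerm j y) (sym no-path-term) ⟩
    pathTerm j y + leafTerm j y    ∎
    where
    open ≡-Reasoning
    eccBound-leaf : eccBound y ≡ suc r
    eccBound-leaf rewrite <⇒<ᵇ-true d<y = refl
    leafTerm-leaf : leafTerm j y ≡ r * suc r
    leafTerm-leaf rewrite ≡ᵇ-refl j | <⇒<ᵇ-true d<y = refl
    no-path-term : pathTerm j y ≡ 0
    no-path-term with y ≡ᵇ suc j in y≡j+1
    ... | false = refl
    ... | true rewrite ≥⇒<ᵇ-false {j} {d} (s≤s⁻¹ (subst (d <_) (≡ᵇ-true⇒≡ y (suc j) y≡j+1) d<y)) = refl

  edgeBound-split : ∀ x y → edgeBound x y ≡ pathTerm x y + leafTerm x y
  edgeBound-split x y with (x <ᵇ y) ∧ adjacent x y in e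
  ... | false = sym (cong₂ _+_ (pathTerm-non-edge x y e) (leafTerm-non-edge x y e))
  ... | true with ∧-true⁻ (x <ᵇ y) (adjacent x y) e
  ...   | x<y , xy with adjacent⇒TreeEdge x y xy
  ...     | path-forward x<d = split-path-edge x<d
  ...     | path-backward _ = ⊥-elim (<⇒≱ (<ᵇ-true⇒< x y x<y) (n≤1+n y))
  ...     | leaf-out d<x    = ⊥-elim (<⇒≱ (≤-<-trans j≤d d<x) (<⇒≤ (<ᵇ-true⇒< x j x<y)))
  ...     | leaf-in d<y     = split-leaf-edge d<y

  rowBound : ℕ → ℕ
  rowBound x = (if x <ᵇ d then eccBound x * eccBound (suc x) else 0) + (if x ≡ᵇ j then (n ∸ suc d) * (r * suc r) else 0)

  ∑-edgeBound : ∀ x → ∑[ y < n ] edgeBound x (toℕ y) ≡ rowBound x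
  ∑-edgeBound x = trans (sum-cong-≗ {n} (λ y → edgeBound-split x (toℕ y)))
                        (trans (∑-distrib-+ {n} (λ y → pathTerm x (toℕ y)) (λ y → leafTerm x (toℕ y)))
                               (cong₂ _+_ path leaf))
    where
    path : ∑[ y < n ] pathTerm x (toℕ y) ≡ (if x <ᵇ d then eccBound x * eccBound (suc x) else 0)
    path with x <ᵇ d in x<d
    ... | true  = ∑-toℕ-indicator _ (≤-trans (s≤s (<ᵇ-true⇒< x d x<d)) d<n)
    ... | false = trans (sum-cong-≗ {n} (λ y → if-zero (toℕ y ≡ᵇ suc x))) (∑-zero n)
    leaf : ∑[ y < n ] leafTerm x (toℕ y) ≡ (if x ≡ᵇ j then (n ∸ suc d) * (r * suc r) else 0)
    leaf with x ≡ᵇ j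
    ... | true  = ∑-tail-const n d (r * suc r)
    ... | false = ∑-zero n

  ∑-rowBound : ∑[ x < n ] rowBound (toℕ x) ≡ g₂ d + (n ∸ suc d) * (r * suc r)
  ∑-rowBound = trans (∑-distrib-+ {n} (λ x → if toℕ x <ᵇ d then eccBound (toℕ x) * eccBound (suc (toℕ x)) else 0) _)
                     (cong₂ _+_ path (∑-toℕ-indicator _ (≤-<-trans j≤d d<n)))
    where
    path : ∑[ x < n ] (if toℕ x <ᵇ d then eccBound (toℕ x) * eccBound (suc (toℕ x)) else 0) ≡ g₂ d
    path = begin
      _                                                    ≡⟨ ∑-truncate (λ x → eccBound x * eccBound (suc x)) (<⇒≤ d<n) ⟩
      ∑[ i < d ] (eccBound (toℕ i) * eccBound (suc (toℕ i))) ≡⟨ sum-cong-≗ {d} on-path ⟩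
      ∑[ i < d ] (δ d (toℕ i) * δ d (suc (toℕ i)))           ≡⟨ sym (g₂≡∑ d) ⟩
      g₂ d                                                 ∎
      where
      open ≡-Reasoning
      on-path : ∀ (i : Fin d) → eccBound (toℕ i) * eccBound (suc (toℕ i)) ≡ δ d (toℕ i) * δ d (suc (toℕ i))
      on-path i = cong₂ _*_ (eccBound-path (<⇒≤ (Fin.toℕ<n i))) (eccBound-path (Fin.toℕ<n i))

  σ₂≤bound : σ₂ T ≤ bound n d
  σ₂≤bound = begin
    σ₂ T
      ≡⟨ σ₂≡∑∑ T ⟩
    ∑[ u < n ] ∑[ v < n ] (if (toℕ u <ᵇ toℕ v) ∧ T u v then ecc T u * ecc T v else 0)
      ≤⟨ ∑-mono-≤ (λ u → ∑-mono-≤ (λ v → if-mono-≤ ((toℕ u <ᵇ toℕ v) ∧ T u v)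
                                                   (*-mono-≤ (ecc≤eccBound u) (ecc≤eccBound v)))) ⟩
    ∑[ u < n ] ∑[ v < n ] edgeBound (toℕ u) (toℕ v)
      ≡⟨ sum-cong-≗ {n} (λ u → ∑-edgeBound (toℕ u)) ⟩
    ∑[ u < n ] rowBound (toℕ u)
      ≡⟨ ∑-rowBound ⟩
    g₂ d + (n ∸ suc d) * (r * suc r)
      ≡⟨ cong₂ (λ k s → g₂ d + k * (r * s)) (sym (∸-+-assoc n 1 d)) (+-comm 1 r) ⟩
    bound n d ∎
    where open ≤-Reasoning

  extremal : IsSimple T × Connected T × diameter T ≡ d × σ₂ T ≡ bound n d
  extremal = simple , connected , diameter≡d , ≤-antisym σ₂≤bound bound≤σ₂
    where
    bound≤σ₂ : bound n d ≤ σ₂ T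
    bound≤σ₂ = subst (λ k → bound n k ≤ σ₂ T) diameter≡d
                     (σ₂-lower-bound n {{>-nonZero (≤-trans (s≤s z≤n) d<n)}} T simple connected)

corollary3p3 : ((n : ℕ) → .{{_ : NonZero n}} → (G : Graph n) → IsSimple G → Connected G →
      bound n (diameter G) ≤ σ₂ G)
    ×
    ((n d j : ℕ) → suc d ≤ n → (2 ≤ d ⊎ n ≡ suc d) → j ≤ d → j ⊔ (d ∸ j) ≡ ⌈ d /2⌉ →
      IsSimple (extremalTree n d j) × Connected (extremalTree n d j)
      × diameter (extremalTree n d j) ≡ d
      × σ₂ (extremalTree n d j) ≡ bound n d)
corollary3p3 = σ₂-lower-bound , ExtremalTree.extremal
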